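{- Let $\mathcal G$ be the group of complex $r$-th roots of unity for some integer $r\ge 2$, and let $\vec T=(\vec T_1,\vec T_2)$ be a $2k$-tuple of edges of $\vec G$. If either (i) $\vec T$ satisfies Condition 1 or Condition 2 at every vertex $b$ of $H$, or (ii) $r=2$ and $\vec T$ satisfies Condition 1, 2 or 3 at every vertex $b$ of $H$, then $\mathcal Q(\vec T_1)\overline{\mathcal Q(\vec T_2)}=1$. Otherwise $E\big(\mathcal Q(\vec T_1)\overline{\mathcal Q(\vec T_2)}\big)=0$.
   Context: $H$ is a connected finite simple graph with no leaves, vertices $1,\dots,t$, $k$ edges, oriented arbitrarily as $\vec H$ with directed edges $\overrightarrow{a_1a_2},\dots,\overrightarrow{a_{2k-1}a_{2k}}$. $\Gamma(b)=\{i:a_i=b\}$; a distinguished index $\iota(b)\in\Gamma(b)$ is fixed. $G$ is a finite simple graph; $\vec G$ replaces each edge $vw$ by $\overrightarrow{vw},\overrightarrow{wv}$. Hash functions $\mathcal X_i:V(G)\to\mathcal G$ ($1\le i\le 2k$): non-distinguished ones chosen independently and uniformly from a $4k$-wise independent family with uniform values; for $i=\iota(b)$, $\mathcal X_i(v)=\prod_{j\in\Gamma(b),j\ne i}\mathcal X_j(v)^{ -1}$ ($=1$ if $\Gamma(b)=\{i\}$). Write $\vec T_1=(\overrightarrow{v_1v_2},\dots,\overrightarrow{v_{2k-1}v_{2k}})$, $\vec T_2=(\overrightarrow{w_1w_2},\dots,\overrightarrow{w_{2k-1}w_{2k}})$; $\mathcal Q(\vec T_1)=\prod_{j=1}^{2k}\mathcal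 X_j(v_j)$, $\mathcal Q(\vec T_2)=\prod_{j=1}^{2k}\mathcal X_j(w_j)$; the bar is complex conjugation. Conditions at $b$: Condition 1: the $v_i$, $i\in\Gamma(b)$, are all equal and the $w_i$, $i\in\Gamma(b)$, are all equal. Condition 2: $v_i=w_i$ for all $i\in\Gamma(b)$. Condition 3: there are vertices $x,y$ of $G$ such that for every $i\in\Gamma(b)$, either ($v_i=x$, $w_i=y$) or ($v_i=y$, $w_i=x$). -}

module Defs where

open import Level using (Level)
open import Data.Nat as ℕ using (ℕ; zero; suc; _≤_; _<_)
open import Data.Fin as Fin using (Fin; combine; _≟_; toℕ)
open import Data.Fin.Properties using (all?)
open import Data.List using (List; length; filter; allFin)
open import Data.Product using (Σ; ∃; ∃-syntax; _×_; _,_)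
open import Data.Sum using (_⊎_)
open import Relation.Nullary using (¬_; does)
open import Relation.Binary.PropositionalEquality using (_≡_; _≢_)
open import Data.Bool using (if_then_else_; _∧_; not)
open import Algebra.Bundles using (CommutativeRing)
open import Function.Definitions using (Injective)

-- Indices 1..2k of the paper are Fin (k * 2);
-- the e-th directed edge (e : Fin k) is  a (tail e) → a (head e),
-- where tail e = combine e 0 ("a_{2e-1}") and head e = combine e 1 ("a_{2e}").

tailIx : ∀ {k} → Fin k → Fin (k ℕ.* 2)
tailIx e = combine e Fin.zero

headIx : ∀ {k} → Fin k → Fin (k ℕ.* 2)
headIx e = combine e (Fin.suc Fin.zero)

InΓ : ∀ {t k} → (Fin (k ℕ.* 2) → Fin t) → Fin t → Fin (k ℕ.* 2) → Set
InΓ a b i = a i ≡ b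

IsSimpleH : ∀ (t k : ℕ) → (Fin (k ℕ.* 2) → Fin t) → Set
IsSimpleH t k a =
  (∀ (e : Fin k) → a (tailIx e) ≢ a (headIx e)) ×
  (∀ (e e′ : Fin k) →
     ((a (tailIx e) ≡ a (tailIx e′) × a (headIx e) ≡ a (headIx e′)) ⊎
      (a (tailIx e) ≡ a (headIx e′) × a (headIx e) ≡ a (tailIx e′))) →
     e ≡ e′)

AdjH : ∀ (t k : ℕ) → (Fin (k ℕ.* 2) → Fin t) → Fin t → Fin t → Set
AdjH t k a x y = Σ (Fin k) λ e → ((a (tailIx e) ≡ x × a (headIx e) ≡ y) ⊎ (a (tailIx e) ≡ y × a (headIx e) ≡ x))

data Reachable (t k : ℕ) (a : Fin (k ℕ.* 2) → Fin t) : Fin t → Fin t → Set where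
  here : ∀ {x} → Reachable t k a x x
  step : ∀ {x y z} → AdjH t k a x y → Reachable t k a y z → Reachable t k a x z

IsConnectedH : ∀ (t k : ℕ) → (Fin (k ℕ.* 2) → Fin t) → Set
IsConnectedH t k a = ∀ (x y : Fin t) → Reachable t k a x y

IsLeaf : ∀ (t k : ℕ) → (Fin (k ℕ.* 2) → Fin t) → Fin t → Set
IsLeaf t k a b = Σ (Fin (k ℕ.* 2)) λ i → (a i ≡ b × (∀ j → a j ≡ b → j ≡ i))

NoLeaves : ∀ (t k : ℕ) → (Fin (k ℕ.* 2) → Fin t) → Set
NoLeaves t k a = ∀ (b : Fin t) → ¬ IsLeaf t k a b

IsDistinguishedChoice : ∀ (t k : ℕ) → (Fin (k ℕ.* 2) → Fin t) → (Fin t → Fin (k ℕ.* 2)) → Set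
IsDistinguishedChoice t k a ι = ∀ (b : Fin t) → a (ι b) ≡ b

IsSimpleGraph : ∀ {n} → (Fin n → Fin n → Set) → Set
IsSimpleGraph {n} Adj = (∀ (x y : Fin n) → Adj x y → Adj y x) × (∀ (x : Fin n) → ¬ Adj x x)

IsEdgeTuple : ∀ (n k : ℕ) → (Fin n → Fin n → Set) → (Fin (k ℕ.* 2) → Fin n) → Set
IsEdgeTuple n k Adj v = ∀ (e : Fin k) → Adj (v (tailIx e)) (v (headIx e))

-- Conditions at a vertex b of H, for T⃗ = (T⃗₁, T⃗₂) given by v, w.

module _ (t k n : ℕ) (a : Fin (k ℕ.* 2) → Fin t) (v w : Fin (k ℕ.* 2) → Fin n) where

  Condition1 : Fin t → Set
  Condition1 b = ∀ i j → a i ≡ b → a j ≡ b → (v i ≡ v j × w i ≡ w j)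

  Condition2 : Fin t → Set
  Condition2 b = ∀ i → a i ≡ b → v i ≡ w i

  Condition3 : Fin t → Set
  Condition3 b = ∃[ x ] ∃[ y ] (∀ i → a i ≡ b → ((v i ≡ x × w i ≡ y) ⊎ (v i ≡ y × w i ≡ x)))

  HypothesisI : Set
  HypothesisI = ∀ (b : Fin t) → Condition1 b ⊎ Condition2 b

  HypothesisII : ℕ → Set
  HypothesisII r = r ≡ 2 × (∀ (b : Fin t) → Condition1 b ⊎ Condition2 b ⊎ Condition3 b)

-- The group 𝒢 of r-th roots of unity is identified with
-- exponents Fin r (u ↦ ζ^u).  A family is a nonempty indexed list
-- F : Fin m → (Fin n → Fin r), sampled uniformly.  It is d-wise
-- independent with uniform values iff for every s ≤ d, all distinct
-- points x_1..x_s and all values y_1..y_s,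
--   Pr[ h(x_j) = y_j for all j ] = r^{-s},
-- i.e.  #{ i | ∀ j, F i (x j) = y j } · r^s = m.

countMatches : ∀ {m n r s} → (Fin m → Fin n → Fin r) → (Fin s → Fin n) → (Fin s → Fin r) → ℕ
countMatches {m} F x y = length (filter (λ i → all? (λ j → F i (x j) ≟ y j)) (allFin m))

IsIndependentFamily : ∀ (m n d r : ℕ) → (Fin m → Fin n → Fin r) → Set
IsIndependentFamily m n d r F =
  ∀ (s : ℕ) → s ≤ d → (x : Fin s → Fin n) → Injective _≡_ _≡_ x →
  (y : Fin s → Fin r) → countMatches F x y ℕ.* (r ℕ.^ s) ≡ m

-- Values in a commutative ring R (an integral domain of characteristic 0
-- containing a primitive r-th root of unity ζ; e.g. ℂ).

module RingStuff {c ℓ : Level} (R : CommutativeRing c ℓ) where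
  open CommutativeRing R

  pow : Carrier → ℕ → Carrier
  pow x zero = 1#
  pow x (suc e) = x * pow x e

  natR : ℕ → Carrier
  natR zero = 0#
  natR (suc e) = 1# + natR e

  IsIntegralDomain : Set (c Level.⊔ ℓ)
  IsIntegralDomain = (¬ (1# ≈ 0#)) × (∀ x y → x * y ≈ 0# → (x ≈ 0# ⊎ y ≈ 0#))

  CharZero : Set ℓ
  CharZero = ∀ (e : ℕ) → natR e ≈ 0# → e ≡ 0

  IsPrimitiveRoot : ℕ → Carrier → Set ℓ
  IsPrimitiveRoot r ζ = pow ζ r ≈ 1# × (∀ j → 0 < j → j < r → ¬ (pow ζ j ≈ 1#))

  sumFin : (m : ℕ) → (Fin m → Carrier) → Carrier
  sumFin zero f = 0#
  sumFin (suc m) f = f Fin.zero + sumFin m (λ i → f (Fin.suc i))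

  prodFin : (m : ℕ) → (Fin m → Carrier) → Carrier
  prodFin zero f = 1#
  prodFin (suc m) f = f Fin.zero * prodFin m (λ i → f (Fin.suc i))

  sumFun : (d m : ℕ) → ((Fin d → Fin m) → Carrier) → Carrier
  sumFun zero m f = f (λ ())
  sumFun (suc d) m f = sumFin m (λ x → sumFun d m (λ g → f (λ { Fin.zero → x ; (Fin.suc i) → g i })))

  -- Group inverse (= complex conjugation) on r-th roots of unity: g ↦ g^(r-1).
  conj : ℕ → Carrier → Carrier
  conj r g = pow g (r ℕ.∸ 1)

  module Hash (t k n m r : ℕ) (ζ : Carrier)
              (a : Fin (k ℕ.* 2) → Fin t) (ι : Fin t → Fin (k ℕ.* 2))
              (F : Fin m → Fin n → Fin r)
              -- σ i : which member of the family is drawn for hash i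
              -- (coordinates at distinguished indices are unused dummies)
              (σ : Fin (k ℕ.* 2) → Fin m) where

    free : Fin (k ℕ.* 2) → Fin n → Carrier
    free j x = pow ζ (toℕ (F (σ j) x))

    𝒳 : Fin (k ℕ.* 2) → Fin n → Carrier
    𝒳 i x = if does (i ≟ ι (a i))
            then prodFin (k ℕ.* 2) (λ j → if does (a j ≟ a i) ∧ not (does (j ≟ i))
                                          then conj r (free j x) else 1#)
            else free i x

    𝒬 : (Fin (k ℕ.* 2) → Fin n) → Carrier
    𝒬 v = prodFin (k ℕ.* 2) (λ j → 𝒳 j (v j))

    Z : (v w : Fin (k ℕ.* 2) → Fin n) → Carrier
    Z v w = 𝒬 v * conj r (𝒬 w)

module Submission where

-- Write every hash value as a power of ζ; conjugation is the power r - 1.  Charging the inverses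
-- carried by each distinguished hash 𝒳_ι(b) to the indices they come from, the exponent of
-- 𝒬(T⃗₁)·conj 𝒬(T⃗₂) becomes a sum over the non-distinguished indices j of terms that each involve
-- only the hash 𝒳_j, evaluated at v_j, v_ι, w_j, w_ι (ι = ι(a_j)) with signs +, -, -, + mod r.
-- Conditions 1-3 at every vertex say exactly that each such term cancels identically (for r = 2 also
-- through - ≡ +), and then the product is ζ^(multiple of r) = 1.  Otherwise one term, read as a formal
-- combination of at most four points, has a coefficient C with r ∤ C.  The sum over all choices of
-- hashes factorises over j, and by 4-wise independence the factor of that term is a multiple of a
-- product of sums Σ_{u<r} ζ^(C'u), one of which vanishes because ζ is primitive.

open import Defs
open import Level using (Level)
open import Algebra.Bundles using (CommutativeRing)
import Algebra.Properties.Semiring.Sum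
open import Data.Bool using (Bool; true; false; if_then_else_; _∧_; not)
open import Data.Bool.Properties using (if-not)
open import Data.Empty using (⊥-elim)
open import Data.Fin as Fin using (Fin; toℕ; _≟_)
open import Data.Fin.Properties using (all?; ¬∀⟶∃¬)
open import Data.List using (List; []; _∷_; length; foldr; lookup; filter; tabulate)
open import Data.List.Membership.Propositional.Properties using (∈-lookup)
open import Data.List.Relation.Unary.All as All using (All; []; _∷_)
open import Data.List.Relation.Unary.AllPairs using (AllPairs; []; _∷_)
open import Data.Nat as ℕ using (ℕ; zero; suc)
import Data.Nat.Properties as ℕ
open import Data.Nat.Divisibility using (_∣_; divides; _∣0; m%n≡0⇒n∣m; >⇒∤; ∣m+n∣m⇒∣n; ∣m∣n⇒∣m+n; ∣-refl)
open import Data.Nat.DivMod using (_%_; _/_; m%n<n; m≡m%n+[m/n]*n)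
open import Data.Nat.Solver using (module +-*-Solver)
open import Data.Product using (Σ; _×_; _,_; proj₁; proj₂)
open import Data.Sum using (_⊎_; inj₁; inj₂)
open import Function using (id; _∘_)
open import Function.Definitions using (Injective)
open import Relation.Nullary using (¬_; Dec; yes; no; does)
open import Relation.Nullary.Decidable using (dec-true; dec-false; _×-dec_; _⊎-dec_)
open import Relation.Binary.PropositionalEquality as ≡ using (_≡_; _≢_)

module ℕΣ = Algebra.Properties.Semiring.Sum ℕ.+-*-semiring

module PowersAndSums {c ℓ : Level} (R : CommutativeRing c ℓ) where
  open CommutativeRing R
  open RingStuff R
  open import Relation.Binary.Reasoning.Setoid setoid

  pow-cong : ∀ e {x y} → x ≈ y → pow x e ≈ pow y e
  pow-cong zero    _   = refl
  pow-cong (suc e) x≈y = *-cong x≈y (pow-cong e x≈y)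

  pow-+ : ∀ x a b → pow x (a ℕ.+ b) ≈ pow x a * pow x b
  pow-+ x zero    b = sym (*-identityˡ _)
  pow-+ x (suc a) b = trans (*-congˡ (pow-+ x a b)) (sym (*-assoc _ _ _))

  pow-* : ∀ x a b → pow (pow x a) b ≈ pow x (a ℕ.* b)
  pow-* x a zero    = reflexive (≡.cong (pow x) (≡.sym (ℕ.*-zeroʳ a)))
  pow-* x a (suc b) = begin
    pow x a * pow (pow x a) b  ≈⟨ *-congˡ (pow-* x a b) ⟩
    pow x a * pow x (a ℕ.* b)  ≈⟨ pow-+ x a (a ℕ.* b) ⟨
    pow x (a ℕ.+ a ℕ.* b)      ≡⟨ ≡.cong (pow x) (ℕ.*-suc a b) ⟨
    pow x (a ℕ.* suc b)        ∎

  pow-1# : ∀ e → pow 1# e ≈ 1#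
  pow-1# zero    = refl
  pow-1# (suc e) = trans (*-identityˡ _) (pow-1# e)

  module _ {x : Carrier} {r : ℕ} (xʳ≈1 : pow x r ≈ 1#) where

    pow-multiple : ∀ q → pow x (q ℕ.* r) ≈ 1#
    pow-multiple q = begin
      pow x (q ℕ.* r)  ≡⟨ ≡.cong (pow x) (ℕ.*-comm q r) ⟩
      pow x (r ℕ.* q)  ≈⟨ pow-* x r q ⟨
      pow (pow x r) q  ≈⟨ pow-cong q xʳ≈1 ⟩
      pow 1# q         ≈⟨ pow-1# q ⟩
      1#               ∎

    pow-mod : ∀ e q → pow x (e ℕ.+ q ℕ.* r) ≈ pow x e
    pow-mod e q = begin
      pow x (e ℕ.+ q ℕ.* r)      ≈⟨ pow-+ x e (q ℕ.* r) ⟩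
      pow x e * pow x (q ℕ.* r)  ≈⟨ *-congˡ (pow-multiple q) ⟩
      pow x e * 1#               ≈⟨ *-identityʳ _ ⟩
      pow x e                    ∎

  sumFin-cong : ∀ m {f g : Fin m → Carrier} → (∀ i → f i ≈ g i) → sumFin m f ≈ sumFin m g
  sumFin-cong zero    f≈g = refl
  sumFin-cong (suc m) f≈g = +-cong (f≈g Fin.zero) (sumFin-cong m (f≈g ∘ Fin.suc))

  sumFin-zero : ∀ m → sumFin m (λ _ → 0#) ≈ 0#
  sumFin-zero zero    = refl
  sumFin-zero (suc m) = trans (+-identityˡ _) (sumFin-zero m)

  sumFin-+ : ∀ m (f g : Fin m → Carrier) → sumFin m (λ i → f i + g i) ≈ sumFin m f + sumFin m g
  sumFin-+ zero    f g = sym (+-identityˡ 0#)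
  sumFin-+ (suc m) f g = begin
    (f₀ + g₀) + sumFin m (λ i → f (Fin.suc i) + g (Fin.suc i))  ≈⟨ +-congˡ (sumFin-+ m (f ∘ Fin.suc) (g ∘ Fin.suc)) ⟩
    (f₀ + g₀) + (Σf + Σg)                                        ≈⟨ solve 4 (λ a b c d → (a ⊕ b) ⊕ (c ⊕ d) ⊜ (a ⊕ c) ⊕ (b ⊕ d)) refl f₀ g₀ Σf Σg ⟩
    (f₀ + Σf) + (g₀ + Σg)                                        ∎
    where
    open import Algebra.Solver.CommutativeMonoid +-commutativeMonoid
    f₀ g₀ Σf Σg : Carrier
    f₀ = f Fin.zero
    g₀ = g Fin.zero
    Σf = sumFin m (f ∘ Fin.suc)
    Σg = sumFin m (g ∘ Fin.suc)

  sumFin-*ˡ : ∀ m x (f : Fin m → Carrier) → sumFin m (λ i → x * f i) ≈ x * sumFin m f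
  sumFin-*ˡ zero    x f = sym (zeroʳ x)
  sumFin-*ˡ (suc m) x f = trans (+-congˡ (sumFin-*ˡ m x (f ∘ Fin.suc))) (sym (distribˡ x _ _))

  sumFin-*ʳ : ∀ m x (f : Fin m → Carrier) → sumFin m (λ i → f i * x) ≈ sumFin m f * x
  sumFin-*ʳ m x f = trans (sumFin-cong m (λ i → *-comm (f i) x)) (trans (sumFin-*ˡ m x f) (*-comm x _))

  sumFin-indicator : ∀ m (i₀ : Fin m) (g : Fin m → Carrier) →
    sumFin m (λ i → if does (i₀ ≟ i) then g i else 0#) ≈ g i₀
  sumFin-indicator (suc m) Fin.zero     g = trans (+-congˡ (sumFin-zero m)) (+-identityʳ _)
  sumFin-indicator (suc m) (Fin.suc i₀) g = trans (+-identityˡ _) (sumFin-indicator m i₀ (g ∘ Fin.suc))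

  prodFin-cong : ∀ m {f g : Fin m → Carrier} → (∀ i → f i ≈ g i) → prodFin m f ≈ prodFin m g
  prodFin-cong zero    f≈g = refl
  prodFin-cong (suc m) f≈g = *-cong (f≈g Fin.zero) (prodFin-cong m (f≈g ∘ Fin.suc))

  prodFin-pow : ∀ x m (e : Fin m → ℕ) → prodFin m (λ j → pow x (e j)) ≈ pow x (ℕΣ.sum e)
  prodFin-pow x zero    e = refl
  prodFin-pow x (suc m) e = trans (*-congˡ (prodFin-pow x m (e ∘ Fin.suc))) (sym (pow-+ x (e Fin.zero) _))

  prodFin-zero : ∀ m (f : Fin m → Carrier) j → f j ≈ 0# → prodFin m f ≈ 0#
  prodFin-zero (suc m) f Fin.zero    fj≈0 = trans (*-congʳ fj≈0) (zeroˡ _)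
  prodFin-zero (suc m) f (Fin.suc j) fj≈0 = trans (*-congˡ (prodFin-zero m (f ∘ Fin.suc) j fj≈0)) (zeroʳ _)

  sumFun-cong : ∀ d m {f g : (Fin d → Fin m) → Carrier} → (∀ σ → f σ ≈ g σ) → sumFun d m f ≈ sumFun d m g
  sumFun-cong zero    m f≈g = f≈g _
  sumFun-cong (suc d) m f≈g = sumFin-cong m (λ _ → sumFun-cong d m (λ _ → f≈g _))

  sumFun-zero : ∀ d m → sumFun d m (λ _ → 0#) ≈ 0#
  sumFun-zero zero    m = refl
  sumFun-zero (suc d) m = trans (sumFin-cong m (λ _ → sumFun-zero d m)) (sumFin-zero m)

  sumFun-+ : ∀ d m (f g : (Fin d → Fin m) → Carrier) → sumFun d m (λ σ → f σ + g σ) ≈ sumFun d m f + sumFun d m g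
  sumFun-+ zero    m f g = refl
  sumFun-+ (suc d) m f g = trans (sumFin-cong m (λ _ → sumFun-+ d m _ _)) (sumFin-+ m _ _)

  sumFun-*ˡ : ∀ d m x (f : (Fin d → Fin m) → Carrier) → sumFun d m (λ σ → x * f σ) ≈ x * sumFun d m f
  sumFun-*ˡ zero    m x f = refl
  sumFun-*ˡ (suc d) m x f = trans (sumFin-cong m (λ _ → sumFun-*ˡ d m x _)) (sumFin-*ˡ m x _)

  sumFun-sumFin : ∀ d m k (f : Fin k → (Fin d → Fin m) → Carrier) →
    sumFun d m (λ σ → sumFin k (λ i → f i σ)) ≈ sumFin k (λ i → sumFun d m (f i))
  sumFun-sumFin d m zero    f = sumFun-zero d m
  sumFun-sumFin d m (suc k) f = trans (sumFun-+ d m _ _) (+-congˡ (sumFun-sumFin d m k (f ∘ Fin.suc)))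

  sumFun-prodFin : ∀ d m (g : Fin d → Fin m → Carrier) →
    sumFun d m (λ σ → prodFin d (λ j → g j (σ j))) ≈ prodFin d (λ j → sumFin m (g j))
  sumFun-prodFin zero    m g = refl
  sumFun-prodFin (suc d) m g = begin
    sumFin m (λ x → sumFun d m (λ τ → g Fin.zero x * prodFin d (λ j → g (Fin.suc j) (τ j))))
      ≈⟨ sumFin-cong m (λ x → sumFun-*ˡ d m (g Fin.zero x) _) ⟩
    sumFin m (λ x → g Fin.zero x * sumFun d m (λ τ → prodFin d (λ j → g (Fin.suc j) (τ j))))
      ≈⟨ sumFin-cong m (λ x → *-congˡ (sumFun-prodFin d m (g ∘ Fin.suc))) ⟩
    sumFin m (λ x → g Fin.zero x * prodFin d (λ j → sumFin m (g (Fin.suc j))))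
      ≈⟨ sumFin-*ʳ m _ (g Fin.zero) ⟩
    sumFin m (g Fin.zero) * prodFin d (λ j → sumFin m (g (Fin.suc j)))
      ∎

  indicator : Bool → Carrier
  indicator b = if b then 1# else 0#

  sumFun-indicator : ∀ d m (σ₀ : Fin d → Fin m) (h : (Fin d → Fin m) → Carrier) →
    (∀ σ σ′ → (∀ j → σ j ≡ σ′ j) → h σ ≈ h σ′) →
    sumFun d m (λ σ → indicator (does (all? (λ j → σ₀ j ≟ σ j))) * h σ) ≈ h σ₀
  sumFun-indicator zero    m σ₀ h h-ext = trans (*-identityˡ _) (h-ext _ _ (λ ()))
  sumFun-indicator (suc d) m σ₀ h h-ext =
    trans (sumFin-cong m (λ x → guarded (σ₀ Fin.zero ≟ x) (sumFun-indicator d m (σ₀ ∘ Fin.suc) _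
                                  (λ τ τ′ τ≗τ′ → h-ext _ _ (λ { Fin.zero → ≡.refl ; (Fin.suc j) → τ≗τ′ j })))))
    (trans (sumFin-indicator m (σ₀ Fin.zero) _)
           (h-ext _ _ (λ { Fin.zero → ≡.refl ; (Fin.suc j) → ≡.refl })))
    where
    -- all? over Fin (suc d) computes to the test at zero ∧ all? over the remaining coordinates.
    guarded : ∀ {A : Set} (a? : Dec A) {X : (Fin d → Fin m) → Bool} {Φ : (Fin d → Fin m) → Carrier} {S} →
      sumFun d m (λ τ → indicator (X τ) * Φ τ) ≈ S →
      sumFun d m (λ τ → indicator (does a? ∧ X τ) * Φ τ) ≈ (if does a? then S else 0#)
    guarded (yes _) ΣXΦ≈S = ΣXΦ≈S
    guarded (no _)  _     = trans (sumFun-cong d m (λ _ → zeroˡ _)) (sumFun-zero d m)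

-- Formal combinations Σ c·[p] of points p of G.  Repeated points are merged by normalise, because
-- independence of the hash family only speaks about distinct points.
module Combinations (n : ℕ) where
  open import Data.Nat using (_+_; _*_; _≤_)
  open +-*-Solver using (solve; _:+_; _:*_; _:=_)
  open import Algebra.Properties.CommutativeSemigroup ℕ.+-commutativeSemigroup using (x∙yz≈y∙xz)

  Term : Set
  Term = Fin n × ℕ

  eval : (Fin n → ℕ) → List Term → ℕ
  eval g []            = 0
  eval g ((p , c) ∷ L) = c * g p + eval g L

  coeffAt : Fin n → Term → ℕ
  coeffAt z (p , c) = if does (p ≟ z) then c else 0

  coeff : Fin n → List Term → ℕ
  coeff z []      = 0
  coeff z (e ∷ L) = coeffAt z e + coeff z L

  DistinctPoints : List Term → Set
  DistinctPoints = AllPairs (λ e e′ → proj₁ e ≢ proj₁ e′)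

  insert : Term → List Term → List Term
  insert e []                   = e ∷ []
  insert (p , c) ((p′ , c′) ∷ L) =
    if does (p ≟ p′) then (p′ , c + c′) ∷ L else (p′ , c′) ∷ insert (p , c) L

  normalise : List Term → List Term
  normalise = foldr insert []

  eval-insert : ∀ g p c L → eval g (insert (p , c) L) ≡ c * g p + eval g L
  eval-insert g p c []              = ≡.refl
  eval-insert g p c ((p′ , c′) ∷ L) with p ≟ p′
  ... | yes ≡.refl = solve 4 (λ c c′ x e → (c :+ c′) :* x :+ e := c :* x :+ (c′ :* x :+ e)) ≡.refl c c′ (g p) (eval g L)
  ... | no  _      = ≡.trans (≡.cong (c′ * g p′ +_) (eval-insert g p c L)) (x∙yz≈y∙xz (c′ * g p′) (c * g p) (eval g L))

  coeff-insert : ∀ z p c L → coeff z (insert (p , c) L) ≡ coeffAt z (p , c) + coeff z L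
  coeff-insert z p c []              = ≡.refl
  coeff-insert z p c ((p′ , c′) ∷ L) with p ≟ p′
  ... | no  _      = ≡.trans (≡.cong (coeffAt z (p′ , c′) +_) (coeff-insert z p c L))
                             (x∙yz≈y∙xz (coeffAt z (p′ , c′)) (coeffAt z (p , c)) (coeff z L))
  ... | yes ≡.refl with p ≟ z
  ...   | yes _ = ℕ.+-assoc c c′ (coeff z L)
  ...   | no  _ = ≡.refl

  All-insert : ∀ {Q : Fin n → Set} p c L → Q p → All (Q ∘ proj₁) L → All (Q ∘ proj₁) (insert (p , c) L)
  All-insert p c []              Qp []         = Qp ∷ []
  All-insert p c ((p′ , c′) ∷ L) Qp (Qp′ ∷ QL) with p ≟ p′
  ... | yes ≡.refl = Qp′ ∷ QL
  ... | no  _      = Qp′ ∷ All-insert p c L Qp QL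

  distinct-insert : ∀ p c L → DistinctPoints L → DistinctPoints (insert (p , c) L)
  distinct-insert p c []              []          = [] ∷ []
  distinct-insert p c ((p′ , c′) ∷ L) (p′∉L ∷ dL) with p ≟ p′
  ... | yes ≡.refl = p′∉L ∷ dL
  ... | no  p≢p′   = All-insert p c L (p≢p′ ∘ ≡.sym) p′∉L ∷ distinct-insert p c L dL

  length-insert : ∀ e L → length (insert e L) ≤ suc (length L)
  length-insert e       []              = ℕ.≤-refl
  length-insert (p , c) ((p′ , c′) ∷ L) with p ≟ p′
  ... | yes _ = ℕ.n≤1+n _
  ... | no  _ = ℕ.s≤s (length-insert (p , c) L)

  eval-normalise : ∀ g L → eval g (normalise L) ≡ eval g L
  eval-normalise g []            = ≡.refl
  eval-normalise g ((p , c) ∷ L) = ≡.trans (eval-insert g p c (normalise L)) (≡.cong (c * g p +_) (eval-normalise g L))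

  coeff-normalise : ∀ z L → coeff z (normalise L) ≡ coeff z L
  coeff-normalise z []            = ≡.refl
  coeff-normalise z ((p , c) ∷ L) = ≡.trans (coeff-insert z p c (normalise L)) (≡.cong (_ +_) (coeff-normalise z L))

  distinct-normalise : ∀ L → DistinctPoints (normalise L)
  distinct-normalise []            = []
  distinct-normalise ((p , c) ∷ L) = distinct-insert p c (normalise L) (distinct-normalise L)

  length-normalise : ∀ L → length (normalise L) ≤ length L
  length-normalise []      = ℕ.z≤n
  length-normalise (e ∷ L) = ℕ.≤-trans (length-insert e (normalise L)) (ℕ.s≤s (length-normalise L))

  eval-lookup : ∀ g L → eval g L ≡ ℕΣ.sum (λ l → proj₂ (lookup L l) * g (proj₁ (lookup L l)))
  eval-lookup g []            = ≡.refl
  eval-lookup g ((p , c) ∷ L) = ≡.cong (c * g p +_) (eval-lookup g L)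

  lookup-injective : ∀ {L} → DistinctPoints L → ∀ {i j} → proj₁ (lookup L i) ≡ proj₁ (lookup L j) → i ≡ j
  lookup-injective (_    ∷ _)  {Fin.zero}  {Fin.zero}  _  = ≡.refl
  lookup-injective (e∉L ∷ _)  {Fin.zero}  {Fin.suc j} eq = ⊥-elim (All.lookup e∉L (∈-lookup j) eq)
  lookup-injective (e∉L ∷ _)  {Fin.suc i} {Fin.zero}  eq = ⊥-elim (All.lookup e∉L (∈-lookup i) (≡.sym eq))
  lookup-injective (_    ∷ dL) {Fin.suc i} {Fin.suc j} eq = ≡.cong Fin.suc (lookup-injective dL eq)

  coeff-absent : ∀ z L → All (λ e → z ≢ proj₁ e) L → coeff z L ≡ 0
  coeff-absent z []            []           = ≡.refl
  coeff-absent z ((p , c) ∷ L) (z≢p ∷ z∉L) with p ≟ z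
  ... | yes p≡z = ⊥-elim (z≢p (≡.sym p≡z))
  ... | no  _   = coeff-absent z L z∉L

  coeff-lookup : ∀ z {L} → DistinctPoints L → coeff z L ≢ 0 → Σ (Fin (length L)) λ l → proj₂ (lookup L l) ≡ coeff z L
  coeff-lookup z {[]}          []          cz≢0 = ⊥-elim (cz≢0 ≡.refl)
  coeff-lookup z {(p , c) ∷ L} (p∉L ∷ dL) cz≢0 with p ≟ z
  ... | yes ≡.refl = Fin.zero , ≡.sym (≡.trans (≡.cong (c +_) (coeff-absent p L p∉L)) (ℕ.+-identityʳ c))
  ... | no  _      = let l , cₗ≡cz = coeff-lookup z dL cz≢0 in Fin.suc l , cₗ≡cz

module FamilyAverages {c ℓ : Level} (R : CommutativeRing c ℓ) where
  open CommutativeRing R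
  open RingStuff R
  open PowersAndSums R
  open import Relation.Binary.Reasoning.Setoid setoid

  natR-length-filter : ∀ {A : Set} {P : A → Set} (P? : ∀ x → Dec (P x)) m (g : Fin m → A) →
    natR (length (filter P? (tabulate g))) ≈ sumFin m (λ i → indicator (does (P? (g i))))
  natR-length-filter P? zero    g = refl
  natR-length-filter P? (suc m) g with does (P? (g Fin.zero))
  ... | true  = +-congˡ (natR-length-filter P? m (g ∘ Fin.suc))
  ... | false = trans (natR-length-filter P? m (g ∘ Fin.suc)) (sym (+-identityˡ _))

  sumFin-groupByValues : ∀ {m n r q} (F : Fin m → Fin n → Fin r) (x : Fin q → Fin n) (h : (Fin q → Fin r) → Carrier) →
    (∀ y y′ → (∀ l → y l ≡ y′ l) → h y ≈ h y′) →
    sumFin m (λ s → h (λ l → F s (x l))) ≈ sumFun q r (λ y → natR (countMatches F x y) * h y)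
  sumFin-groupByValues {m} {r = r} {q} F x h h-ext = sym (begin
    sumFun q r (λ y → natR (countMatches F x y) * h y)
      ≈⟨ sumFun-cong q r (λ y → *-congʳ (natR-length-filter (matches y) m id)) ⟩
    sumFun q r (λ y → sumFin m (λ s → indicator (does (matches y s))) * h y)
      ≈⟨ sumFun-cong q r (λ y → sym (sumFin-*ʳ m (h y) _)) ⟩
    sumFun q r (λ y → sumFin m (λ s → indicator (does (matches y s)) * h y))
      ≈⟨ sumFun-sumFin q r m _ ⟩
    sumFin m (λ s → sumFun q r (λ y → indicator (does (matches y s)) * h y))
      ≈⟨ sumFin-cong m (λ s → sumFun-indicator q r (λ l → F s (x l)) h h-ext) ⟩
    sumFin m (λ s → h (λ l → F s (x l))) ∎)
    where
    matches : (y : Fin q → Fin r) (s : Fin m) → Dec (∀ l → F s (x l) ≡ y l)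
    matches y s = all? (λ l → F s (x l) ≟ y l)

  countMatches-uniform : ∀ {m n d r q} .{{_ : ℕ.NonZero r}} (F : Fin m → Fin n → Fin r) → IsIndependentFamily m n d r F →
    (x : Fin q → Fin n) → q ℕ.≤ d → Injective _≡_ _≡_ x → ∀ y y′ → countMatches F x y ≡ countMatches F x y′
  countMatches-uniform {r = r} {q} F independent x q≤d x-inj y y′ =
    ℕ.*-cancelʳ-≡ _ _ (r ℕ.^ q) {{ℕ.m^n≢0 r q}}
      (≡.trans (independent q q≤d x x-inj y) (≡.sym (independent q q≤d x x-inj y′)))

module CharacterSums {c ℓ : Level} (R : CommutativeRing c ℓ) (domain : RingStuff.IsIntegralDomain R) where
  open CommutativeRing R
  open RingStuff R
  open PowersAndSums R
  open FamilyAverages R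
  open import Algebra.Properties.Group +-group using (∙-cancelˡ; x∙y⁻¹≈ε⇒x≈y; x≈y⇒x∙y⁻¹≈ε)
  open import Algebra.Properties.Ring ring using ([y-z]x≈yx-zx)
  open import Relation.Binary.Reasoning.Setoid setoid

  geometricSum : Carrier → ℕ → Carrier
  geometricSum ω N = sumFin N (λ u → pow ω (toℕ u))

  geometricSum-suc : ∀ ω N → geometricSum ω (suc N) ≈ 1# + ω * geometricSum ω N
  geometricSum-suc ω N = +-congˡ (sumFin-*ˡ N ω _)

  geometricSum-shift : ∀ ω N → geometricSum ω N + pow ω N ≈ 1# + ω * geometricSum ω N
  geometricSum-shift ω zero    = trans (+-identityˡ 1#) (sym (trans (+-congˡ (zeroʳ ω)) (+-identityʳ 1#)))
  geometricSum-shift ω (suc N) = begin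
    geometricSum ω (suc N) + ω * pow ω N          ≈⟨ +-congʳ (geometricSum-suc ω N) ⟩
    (1# + ω * geometricSum ω N) + ω * pow ω N     ≈⟨ +-assoc _ _ _ ⟩
    1# + (ω * geometricSum ω N + ω * pow ω N)     ≈⟨ +-congˡ (distribˡ ω _ _) ⟨
    1# + ω * (geometricSum ω N + pow ω N)         ≈⟨ +-congˡ (*-congˡ (geometricSum-shift ω N)) ⟩
    1# + ω * (1# + ω * geometricSum ω N)          ≈⟨ +-congˡ (*-congˡ (geometricSum-suc ω N)) ⟨
    1# + ω * geometricSum ω (suc N)               ∎

  geometricSum-vanishes : ∀ {ω} N → ¬ ω ≈ 1# → pow ω N ≈ 1# → geometricSum ω N ≈ 0#
  geometricSum-vanishes {ω} N ω≉1 ωᴺ≈1 with proj₂ domain (ω - 1#) S [ω-1]S≈0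
    where
    S : Carrier
    S = geometricSum ω N
    ωS≈S : ω * S ≈ S
    ωS≈S = sym (∙-cancelˡ 1# S (ω * S) (begin
      1# + S        ≈⟨ +-comm 1# S ⟩
      S + 1#        ≈⟨ +-congˡ ωᴺ≈1 ⟨
      S + pow ω N   ≈⟨ geometricSum-shift ω N ⟩
      1# + ω * S    ∎))
    [ω-1]S≈0 : (ω - 1#) * S ≈ 0#
    [ω-1]S≈0 = begin
      (ω - 1#) * S     ≈⟨ [y-z]x≈yx-zx S ω 1# ⟩
      ω * S - 1# * S   ≈⟨ +-congˡ (-‿cong (*-identityˡ S)) ⟩
      ω * S - S        ≈⟨ x≈y⇒x∙y⁻¹≈ε ωS≈S ⟩
      0#               ∎
  ... | inj₁ ω-1≈0 = ⊥-elim (ω≉1 (x∙y⁻¹≈ε⇒x≈y ω 1# ω-1≈0))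
  ... | inj₂ S≈0   = S≈0

  rootPowerSum-vanishes : ∀ r .{{_ : ℕ.NonZero r}} {ζ} → IsPrimitiveRoot r ζ →
    ∀ C → ¬ r ∣ C → sumFin r (λ u → pow ζ (C ℕ.* toℕ u)) ≈ 0#
  rootPowerSum-vanishes r {ζ} (ζʳ≈1 , ζʲ≉1) C r∤C =
    trans (sumFin-cong r (λ u → sym (pow-* ζ C (toℕ u)))) (geometricSum-vanishes r ζᶜ≉1 [ζᶜ]ʳ≈1)
    where
    [ζᶜ]ʳ≈1 : pow (pow ζ C) r ≈ 1#
    [ζᶜ]ʳ≈1 = trans (pow-* ζ C r) (pow-multiple ζʳ≈1 C)
    ζᶜ≉1 : ¬ pow ζ C ≈ 1#
    ζᶜ≉1 ζᶜ≈1 = ζʲ≉1 (C % r) (ℕ.n≢0⇒n>0 (r∤C ∘ m%n≡0⇒n∣m C r)) (m%n<n C r) (begin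
      pow ζ (C % r)                 ≈⟨ pow-mod ζʳ≈1 (C % r) (C / r) ⟨
      pow ζ (C % r ℕ.+ C / r ℕ.* r) ≡⟨ ≡.cong (pow ζ) (m≡m%n+[m/n]*n C r) ⟨
      pow ζ C                       ≈⟨ ζᶜ≈1 ⟩
      1#                            ∎)

  module _ {r : ℕ} .{{_ : ℕ.NonZero r}} {ζ : Carrier} (ζ-primitive : IsPrimitiveRoot r ζ) where

    sumFun-character-vanishes : ∀ q (C : Fin q → ℕ) l → ¬ r ∣ C l →
      sumFun q r (λ y → pow ζ (ℕΣ.sum (λ l → C l ℕ.* toℕ (y l)))) ≈ 0#
    sumFun-character-vanishes q C l r∤Cₗ = begin
      sumFun q r (λ y → pow ζ (ℕΣ.sum (λ l → C l ℕ.* toℕ (y l))))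
        ≈⟨ sumFun-cong q r (λ y → sym (prodFin-pow ζ q (λ l → C l ℕ.* toℕ (y l)))) ⟩
      sumFun q r (λ y → prodFin q (λ l → pow ζ (C l ℕ.* toℕ (y l))))
        ≈⟨ sumFun-prodFin q r (λ l u → pow ζ (C l ℕ.* toℕ u)) ⟩
      prodFin q (λ l → sumFin r (λ u → pow ζ (C l ℕ.* toℕ u)))
        ≈⟨ prodFin-zero q _ l (rootPowerSum-vanishes r ζ-primitive (C l) r∤Cₗ) ⟩
      0# ∎

    familySum-vanishes : ∀ {m n d} (F : Fin m → Fin n → Fin r) → IsIndependentFamily m n d r F →
      ∀ L → length L ℕ.≤ d → ∀ z → ¬ r ∣ Combinations.coeff n z L →
      sumFin m (λ s → pow ζ (Combinations.eval n (λ p → toℕ (F s p)) L)) ≈ 0#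
    familySum-vanishes {m} {n} F independent L |L|≤d z r∤cz = begin
      sumFin m (λ s → pow ζ (eval (λ p → toℕ (F s p)) L))
        ≈⟨ sumFin-cong m (λ s → reflexive (≡.cong (pow ζ) (≡.trans (≡.sym (eval-normalise _ L)) (eval-lookup _ L′)))) ⟩
      sumFin m (λ s → h (λ l → F s (x l)))
        ≈⟨ sumFin-groupByValues F x h h-ext ⟩
      sumFun q r (λ y → natR (countMatches F x y) * h y)
        ≈⟨ sumFun-cong q r (λ y → *-congʳ (reflexive (≡.cong natR (uniform y y₀)))) ⟩
      sumFun q r (λ y → natR (countMatches F x y₀) * h y)
        ≈⟨ sumFun-*ˡ q r _ h ⟩
      natR (countMatches F x y₀) * sumFun q r h
        ≈⟨ *-congˡ (sumFun-character-vanishes q C l r∤Cₗ) ⟩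
      natR (countMatches F x y₀) * 0#
        ≈⟨ zeroʳ _ ⟩
      0# ∎
      where
      open Combinations n
      L′ : List Term
      L′ = normalise L
      q : ℕ
      q = length L′
      x : Fin q → Fin n
      x l = proj₁ (lookup L′ l)
      C : Fin q → ℕ
      C l = proj₂ (lookup L′ l)
      h : (Fin q → Fin r) → Carrier
      h y = pow ζ (ℕΣ.sum (λ l → C l ℕ.* toℕ (y l)))
      h-ext : ∀ y y′ → (∀ l → y l ≡ y′ l) → h y ≈ h y′
      h-ext y y′ y≗y′ = reflexive (≡.cong (pow ζ) (ℕΣ.sum-cong-≗ (λ l → ≡.cong (λ u → C l ℕ.* toℕ u) (y≗y′ l))))
      y₀ : Fin q → Fin r
      y₀ _ = Fin.fromℕ< (ℕ.>-nonZero⁻¹ r)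
      uniform : ∀ y y′ → countMatches F x y ≡ countMatches F x y′
      uniform = countMatches-uniform F independent x (ℕ.≤-trans (length-normalise L) |L|≤d)
                  (lookup-injective (distinct-normalise L))
      r∤cz′ : ¬ r ∣ coeff z L′
      r∤cz′ = r∤cz ∘ ≡.subst (r ∣_) (coeff-normalise z L)
      entry : Σ (Fin q) λ l → C l ≡ coeff z L′
      entry = coeff-lookup z (distinct-normalise L) (λ cz′≡0 → r∤cz′ (≡.subst (r ∣_) (≡.sym cz′≡0) (r ∣0)))
      l : Fin q
      l = proj₁ entry
      r∤Cₗ : ¬ r ∣ C l
      r∤Cₗ = r∤cz′ ∘ ≡.subst (r ∣_) (proj₂ entry)

module FourTerms (n r′ : ℕ) where
  open import Data.Nat using (_+_; _*_)
  open +-*-Solver using (solve; _:+_; _:*_; _:=_; con)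
  open Combinations n

  -- Conjugation on r-th roots of unity is the power ρ = r - 1, so cross α β γ δ is the exponent of
  -- ζ^α · conj ζ^β · conj (ζ^γ · conj ζ^δ), that is α - β - γ + δ modulo r.
  ρ r : ℕ
  ρ = suc r′
  r = suc ρ

  cross : ℕ → ℕ → ℕ → ℕ → ℕ
  cross α β γ δ = (α + β * ρ) + (γ + δ * ρ) * ρ

  Cancelling : {X : Set} → X → X → X → X → Set
  Cancelling A B C D = (A ≡ B × C ≡ D) ⊎ (A ≡ C × B ≡ D) ⊎ (r ≡ 2 × A ≡ D × B ≡ C)

  cancelling-map : ∀ {X Y : Set} (g : X → Y) {A B C D} → Cancelling A B C D → Cancelling (g A) (g B) (g C) (g D)
  cancelling-map g (inj₁ (A≡B , C≡D))              = inj₁ (≡.cong g A≡B , ≡.cong g C≡D)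
  cancelling-map g (inj₂ (inj₁ (A≡C , B≡D)))       = inj₂ (inj₁ (≡.cong g A≡C , ≡.cong g B≡D))
  cancelling-map g (inj₂ (inj₂ (r≡2 , A≡D , B≡C))) = inj₂ (inj₂ (r≡2 , ≡.cong g A≡D , ≡.cong g B≡C))

  cancelling? : ∀ (A B C D : Fin n) → Dec (Cancelling A B C D)
  cancelling? A B C D = ((A ≟ B) ×-dec (C ≟ D)) ⊎-dec ((A ≟ C) ×-dec (B ≟ D)) ⊎-dec ((r ℕ.≟ 2) ×-dec (A ≟ D) ×-dec (B ≟ C))

  cancelling-diagonal : ∀ {X : Set} {A B C D : X} → Cancelling A B C D → B ≡ D → A ≡ C
  cancelling-diagonal (inj₁ (A≡B , C≡D))             B≡D = ≡.trans A≡B (≡.trans B≡D (≡.sym C≡D))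
  cancelling-diagonal (inj₂ (inj₁ (A≡C , _)))        _   = A≡C
  cancelling-diagonal (inj₂ (inj₂ (_ , A≡D , B≡C))) B≡D = ≡.trans A≡D (≡.trans (≡.sym B≡D) B≡C)

  cancelling-offDiagonal : ∀ {X : Set} {A B C D : X} → Cancelling A B C D → B ≢ D →
    (A ≡ B × C ≡ D) ⊎ (r ≡ 2 × A ≡ D × C ≡ B)
  cancelling-offDiagonal (inj₁ A≡B×C≡D)                  _   = inj₁ A≡B×C≡D
  cancelling-offDiagonal (inj₂ (inj₁ (_ , B≡D)))         B≢D = ⊥-elim (B≢D B≡D)
  cancelling-offDiagonal (inj₂ (inj₂ (r≡2 , A≡D , B≡C))) _   = inj₂ (r≡2 , A≡D , ≡.sym B≡C)

  cancelling⇒∣cross : ∀ {α β γ δ} → Cancelling α β γ δ → r ∣ cross α β γ δ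
  cancelling⇒∣cross {α} {_} {γ} (inj₁ (≡.refl , ≡.refl)) = divides (α + γ * ρ)
    (solve 3 (λ α γ ρ → (α :+ α :* ρ) :+ (γ :+ γ :* ρ) :* ρ := (α :+ γ :* ρ) :* (con 1 :+ ρ)) ≡.refl α γ ρ)
  cancelling⇒∣cross {α} {β} (inj₂ (inj₁ (≡.refl , ≡.refl))) = divides (α + β * ρ)
    (solve 3 (λ α β ρ → (α :+ β :* ρ) :+ (α :+ β :* ρ) :* ρ := (α :+ β :* ρ) :* (con 1 :+ ρ)) ≡.refl α β ρ)
  cancelling⇒∣cross {α} {β} (inj₂ (inj₂ (r≡2 , ≡.refl , ≡.refl))) rewrite ℕ.suc-injective (ℕ.suc-injective r≡2) =
    divides (α + β) (solve 2 (λ α β → (α :+ β :* con 1) :+ (β :+ α :* con 1) :* con 1 := (α :+ β) :* con 2) ≡.refl α β)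

  terms : Fin n → Fin n → Fin n → Fin n → List Term
  terms A B C D = (A , 1) ∷ (B , ρ) ∷ (C , ρ) ∷ (D , 1) ∷ []

  -- ρ² = 1 + r′ · r.
  cross-eval : ∀ g A B C D → cross (g A) (g B) (g C) (g D) ≡ eval g (terms A B C D) + r′ * g D * r
  cross-eval g A B C D = solve 5
    (λ r′ α β γ δ → (α :+ β :* (con 1 :+ r′)) :+ (γ :+ δ :* (con 1 :+ r′)) :* (con 1 :+ r′)
                  := (con 1 :* α :+ ((con 1 :+ r′) :* β :+ ((con 1 :+ r′) :* γ :+ (con 1 :* δ :+ con 0))))
                     :+ r′ :* δ :* (con 2 :+ r′))
    ≡.refl r′ (g A) (g B) (g C) (g D)

  r∤1 : ¬ r ∣ 1
  r∤1 = >⇒∤ (ℕ.s≤s (ℕ.s≤s ℕ.z≤n))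

  r∤ρ : ¬ r ∣ ρ
  r∤ρ = >⇒∤ (ℕ.n<1+n ρ)

  r∤-resp : ∀ {k l} → ¬ r ∣ k → l ≡ k → ¬ r ∣ l
  r∤-resp r∤k ≡.refl = r∤k

  r∤1+2ρ : ¬ r ∣ 1 + (ρ + ρ)
  r∤1+2ρ r∣r+ρ = r∤ρ (∣m+n∣m⇒∣n {m = r} r∣r+ρ ∣-refl)

  r≢2⇒r∤2 : r ≢ 2 → ¬ r ∣ 2
  r≢2⇒r∤2 r≢2 = >⇒∤ (ℕ.≤∧≢⇒< (ℕ.s≤s (ℕ.s≤s ℕ.z≤n)) (r≢2 ∘ ≡.sym))

  coeffAt-hit : ∀ {z} p c → p ≡ z → coeffAt z (p , c) ≡ c
  coeffAt-hit {z} p c p≡z rewrite dec-true (p ≟ z) p≡z = ≡.refl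

  coeffAt-miss : ∀ {z} p c → p ≢ z → coeffAt z (p , c) ≡ 0
  coeffAt-miss {z} p c p≢z rewrite dec-false (p ≟ z) p≢z = ≡.refl

  coeff-terms : ∀ z A B C D {a b c d} → coeffAt z (A , 1) ≡ a → coeffAt z (B , ρ) ≡ b →
    coeffAt z (C , ρ) ≡ c → coeffAt z (D , 1) ≡ d → coeff z (terms A B C D) ≡ a + (b + (c + (d + 0)))
  coeff-terms z A B C D ≡.refl ≡.refl ≡.refl ≡.refl = ≡.refl

  -- The coefficient exhibited is 1, 2 (r ≠ 2), ρ or 1 + 2ρ.
  ¬cancelling⇒∤coeff : ∀ A B C D → ¬ Cancelling A B C D → Σ (Fin n) λ z → ¬ r ∣ coeff z (terms A B C D)
  ¬cancelling⇒∤coeff A B C D ¬cancel with B ≟ A | C ≟ A | D ≟ A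
  ... | no B≢A | no C≢A | no D≢A =
    A , r∤-resp r∤1 (coeff-terms A A B C D (coeffAt-hit A 1 ≡.refl) (coeffAt-miss B ρ B≢A) (coeffAt-miss C ρ C≢A) (coeffAt-miss D 1 D≢A))
  ... | no B≢A | no C≢A | yes D≡A with r ℕ.≟ 2 | C ≟ B
  ...   | no r≢2 | _        =
    A , r∤-resp (r≢2⇒r∤2 r≢2) (coeff-terms A A B C D (coeffAt-hit A 1 ≡.refl) (coeffAt-miss B ρ B≢A) (coeffAt-miss C ρ C≢A) (coeffAt-hit D 1 D≡A))
  ...   | yes r≡2 | yes C≡B = ⊥-elim (¬cancel (inj₂ (inj₂ (r≡2 , ≡.sym D≡A , ≡.sym C≡B))))
  ...   | yes _   | no C≢B  =
    B , r∤-resp r∤ρ (≡.trans (coeff-terms B A B C D (coeffAt-miss A 1 (B≢A ∘ ≡.sym)) (coeffAt-hit B ρ ≡.refl) (coeffAt-miss C ρ C≢B)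
                    (coeffAt-miss D 1 (λ D≡B → B≢A (≡.trans (≡.sym D≡B) D≡A)))) (ℕ.+-identityʳ ρ))
  ¬cancelling⇒∤coeff A B C D ¬cancel | yes B≡A | yes C≡A | yes D≡A =
    ⊥-elim (¬cancel (inj₁ (≡.sym B≡A , ≡.trans C≡A (≡.sym D≡A))))
  ¬cancelling⇒∤coeff A B C D ¬cancel | yes B≡A | yes C≡A | no D≢A  =
    A , r∤-resp r∤1+2ρ (≡.trans (coeff-terms A A B C D (coeffAt-hit A 1 ≡.refl) (coeffAt-hit B ρ B≡A) (coeffAt-hit C ρ C≡A) (coeffAt-miss D 1 D≢A))
                              (≡.cong (λ x → 1 + (ρ + x)) (ℕ.+-identityʳ ρ)))
  ¬cancelling⇒∤coeff A B C D ¬cancel | yes B≡A | no C≢A  | _ with D ≟ C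
  ... | yes D≡C = ⊥-elim (¬cancel (inj₁ (≡.sym B≡A , ≡.sym D≡C)))
  ... | no D≢C  =
    C , r∤-resp r∤ρ (≡.trans (coeff-terms C A B C D (coeffAt-miss A 1 (C≢A ∘ ≡.sym)) (coeffAt-miss B ρ (λ B≡C → C≢A (≡.trans (≡.sym B≡C) B≡A)))
                    (coeffAt-hit C ρ ≡.refl) (coeffAt-miss D 1 D≢C)) (ℕ.+-identityʳ ρ))
  ¬cancelling⇒∤coeff A B C D ¬cancel | no B≢A  | yes C≡A | _ with D ≟ B
  ... | yes D≡B = ⊥-elim (¬cancel (inj₂ (inj₁ (≡.sym C≡A , ≡.sym D≡B))))
  ... | no D≢B  =
    B , r∤-resp r∤ρ (≡.trans (coeff-terms B A B C D (coeffAt-miss A 1 (B≢A ∘ ≡.sym)) (coeffAt-hit B ρ ≡.refl)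
                    (coeffAt-miss C ρ (λ C≡B → B≢A (≡.trans (≡.sym C≡B) C≡A))) (coeffAt-miss D 1 D≢B)) (ℕ.+-identityʳ ρ))

module Redistribution {t N : ℕ} (a : Fin N → Fin t) (ι : Fin t → Fin N) (ι∈Γ : ∀ b → a (ι b) ≡ b) where
  open import Data.Nat using (_+_)

  distinguished : Fin N → Bool
  distinguished i = does (i ≟ ι (a i))

  sibling : Fin N → Fin N → Bool
  sibling j i = does (a j ≟ a i) ∧ not (does (j ≟ i))

  sum-indicator : ∀ {M} (i₀ : Fin M) (g : Fin M → ℕ) → ℕΣ.sum (λ i → if does (i₀ ≟ i) then g i else 0) ≡ g i₀
  sum-indicator {suc M} Fin.zero     g = ≡.trans (≡.cong (g Fin.zero +_) (ℕΣ.sum-replicate-zero M)) (ℕ.+-identityʳ _)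
  sum-indicator {suc M} (Fin.suc i₀) g = sum-indicator i₀ (g ∘ Fin.suc)

  sibling-of-distinguished : ∀ i j x →
    (if distinguished i then (if sibling j i then x else 0) else 0) ≡
    (if does (ι (a j) ≟ i) then (if distinguished j then 0 else x) else 0)
  sibling-of-distinguished i j x with ι (a j) ≟ i
  ... | yes ≡.refl
        rewrite dec-true (ι (a j) ≟ ι (a (ι (a j)))) (≡.cong ι (≡.sym (ι∈Γ (a j))))
              | dec-true (a j ≟ a (ι (a j))) (≡.sym (ι∈Γ (a j))) = if-not (distinguished j)
  ... | no ιaj≢i with i ≟ ι (a i) | a j ≟ a i
  ...   | no  _        | _        = ≡.refl
  ...   | yes _        | no  _    = ≡.refl
  ...   | yes i≡ιai    | yes aj≡ai = ⊥-elim (ιaj≢i (≡.trans (≡.cong ι aj≡ai) (≡.sym i≡ιai)))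

  -- The distinguished index of a vertex carries the conjugated hashes of its siblings; regrouping hands
  -- each of them back to the sibling j it comes from, evaluated at the point u (ι (a j)).
  sum-redistribute : ∀ (F : Fin N → ℕ) (G : Fin N → Fin N → ℕ) →
    ℕΣ.sum (λ i → if distinguished i then ℕΣ.sum (λ j → if sibling j i then G j i else 0) else F i) ≡
    ℕΣ.sum (λ j → if distinguished j then 0 else F j + G j (ι (a j)))
  sum-redistribute F G = begin
    ℕΣ.sum (λ i → if distinguished i then ℕΣ.sum (λ j → if sibling j i then G j i else 0) else F i)
      ≡⟨ ℕΣ.sum-cong-≗ split ⟩
    ℕΣ.sum (λ i → own i + ℕΣ.sum (λ j → T i j))
      ≡⟨ ℕΣ.∑-distrib-+ own (λ i → ℕΣ.sum (T i)) ⟩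
    ℕΣ.sum own + ℕΣ.sum (λ i → ℕΣ.sum (T i))
      ≡⟨ ≡.cong (ℕΣ.sum own +_) (ℕΣ.∑-comm T) ⟩
    ℕΣ.sum own + ℕΣ.sum (λ j → ℕΣ.sum (λ i → T i j))
      ≡⟨ ≡.cong (ℕΣ.sum own +_) (ℕΣ.sum-cong-≗ collect) ⟩
    ℕΣ.sum own + ℕΣ.sum inherited
      ≡⟨ ℕΣ.∑-distrib-+ own inherited ⟨
    ℕΣ.sum (λ j → own j + inherited j)
      ≡⟨ ℕΣ.sum-cong-≗ merge ⟩
    ℕΣ.sum (λ j → if distinguished j then 0 else F j + G j (ι (a j))) ∎
    where
    open ≡.≡-Reasoning
    own inherited : Fin N → ℕ
    own i = if distinguished i then 0 else F i
    inherited j = if distinguished j then 0 else G j (ι (a j))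
    T : Fin N → Fin N → ℕ
    T i j = if distinguished i then (if sibling j i then G j i else 0) else 0
    split : ∀ i → (if distinguished i then ℕΣ.sum (λ j → if sibling j i then G j i else 0) else F i) ≡
                  own i + ℕΣ.sum (T i)
    split i with distinguished i
    ... | true  = ≡.refl
    ... | false = ≡.sym (≡.trans (≡.cong (F i +_) (ℕΣ.sum-replicate-zero N)) (ℕ.+-identityʳ (F i)))
    collect : ∀ j → ℕΣ.sum (λ i → T i j) ≡ inherited j
    collect j = ≡.trans (ℕΣ.sum-cong-≗ (λ i → sibling-of-distinguished i j (G j i))) (sum-indicator (ι (a j)) _)
    merge : ∀ j → own j + inherited j ≡ (if distinguished j then 0 else F j + G j (ι (a j)))
    merge j with distinguished j
    ... | true  = ≡.refl
    ... | false = ≡.refl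

module HashExponent {c ℓ : Level} (R : CommutativeRing c ℓ) {t k n m r′ : ℕ} (ζ : CommutativeRing.Carrier R)
                    (a : Fin (k ℕ.* 2) → Fin t) (ι : Fin t → Fin (k ℕ.* 2)) (ι∈Γ : ∀ b → a (ι b) ≡ b)
                    (F : Fin m → Fin n → Fin (suc (suc r′))) (v w : Fin (k ℕ.* 2) → Fin n) where
  open CommutativeRing R
  open RingStuff R
  open PowersAndSums R
  open Redistribution a ι ι∈Γ
  open FourTerms n r′ using (ρ; r; cross)
  open import Relation.Binary.Reasoning.Setoid setoid

  -- Z = ζ ^ Σ_j weight (F (σ j)) j (Z-pow): each index j only involves its own hash.
  weight : (Fin n → Fin r) → Fin (k ℕ.* 2) → ℕ
  weight h j = if distinguished j then 0 else
    cross (toℕ (h (v j))) (toℕ (h (v (ι (a j))))) (toℕ (h (w j))) (toℕ (h (w (ι (a j)))))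

  module _ (σ : Fin (k ℕ.* 2) → Fin m) where
    open Hash t k n m r ζ a ι F σ

    f : Fin (k ℕ.* 2) → Fin n → ℕ
    f j x = toℕ (F (σ j) x)

    exponent : (Fin (k ℕ.* 2) → Fin n) → ℕ
    exponent u = ℕΣ.sum (λ j → if distinguished j then 0 else f j (u j) ℕ.+ f j (u (ι (a j))) ℕ.* ρ)

    𝒳-exponent : Fin (k ℕ.* 2) → Fin n → ℕ
    𝒳-exponent i x = if distinguished i then ℕΣ.sum (λ j → if sibling j i then f j x ℕ.* ρ else 0) else f i x

    𝒳-pow : ∀ i x → 𝒳 i x ≈ pow ζ (𝒳-exponent i x)
    𝒳-pow i x with distinguished i
    ... | true  = trans (prodFin-cong (k ℕ.* 2) (λ j → conj-pow (sibling j i) (f j x))) (prodFin-pow ζ (k ℕ.* 2) _)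
      where
      conj-pow : ∀ b e → (if b then conj r (pow ζ e) else 1#) ≈ pow ζ (if b then e ℕ.* ρ else 0)
      conj-pow true  e = pow-* ζ e ρ
      conj-pow false e = refl
    ... | false = refl

    𝒬-pow : ∀ u → 𝒬 u ≈ pow ζ (exponent u)
    𝒬-pow u = begin
      𝒬 u                                                    ≈⟨ prodFin-cong (k ℕ.* 2) (λ i → 𝒳-pow i (u i)) ⟩
      prodFin (k ℕ.* 2) (λ i → pow ζ (𝒳-exponent i (u i)))  ≈⟨ prodFin-pow ζ (k ℕ.* 2) (λ i → 𝒳-exponent i (u i)) ⟩
      pow ζ (ℕΣ.sum (λ i → 𝒳-exponent i (u i)))             ≡⟨ ≡.cong (pow ζ) (sum-redistribute (λ i → f i (u i)) (λ j i → f j (u i) ℕ.* ρ)) ⟩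
      pow ζ (exponent u)                                     ∎

    exponent-cross : exponent v ℕ.+ exponent w ℕ.* ρ ≡ ℕΣ.sum (λ j → weight (F (σ j)) j)
    exponent-cross = ≡.trans (≡.cong (exponent v ℕ.+_) (ℕΣ.*-distribʳ-sum ρ owed))
                    (≡.trans (≡.sym (ℕΣ.∑-distrib-+ own (λ j → owed j ℕ.* ρ))) (ℕΣ.sum-cong-≗ pointwise))
      where
      own owed : Fin (k ℕ.* 2) → ℕ
      own  j = if distinguished j then 0 else f j (v j) ℕ.+ f j (v (ι (a j))) ℕ.* ρ
      owed j = if distinguished j then 0 else f j (w j) ℕ.+ f j (w (ι (a j))) ℕ.* ρ
      pointwise : ∀ j → own j ℕ.+ owed j ℕ.* ρ ≡ weight (F (σ j)) j
      pointwise j with distinguished j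
      ... | true  = ≡.refl
      ... | false = ≡.refl

    Z-pow : Z v w ≈ pow ζ (ℕΣ.sum (λ j → weight (F (σ j)) j))
    Z-pow = begin
      𝒬 v * pow (𝒬 w) ρ                           ≈⟨ *-cong (𝒬-pow v) (pow-cong ρ (𝒬-pow w)) ⟩
      pow ζ (exponent v) * pow (pow ζ (exponent w)) ρ ≈⟨ *-congˡ (pow-* ζ (exponent w) ρ) ⟩
      pow ζ (exponent v) * pow ζ (exponent w ℕ.* ρ)   ≈⟨ pow-+ ζ (exponent v) _ ⟨
      pow ζ (exponent v ℕ.+ exponent w ℕ.* ρ)         ≡⟨ ≡.cong (pow ζ) exponent-cross ⟩
      pow ζ (ℕΣ.sum (λ j → weight (F (σ j)) j))       ∎

module Pairing {t k n : ℕ} (r′ : ℕ) (a : Fin (k ℕ.* 2) → Fin t) (ι : Fin t → Fin (k ℕ.* 2)) (ι∈Γ : ∀ b → a (ι b) ≡ b)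
               (v w : Fin (k ℕ.* 2) → Fin n) where
  open FourTerms n r′ using (r; Cancelling; cancelling-diagonal; cancelling-offDiagonal)

  -- Conditions 1-3 at the vertex a j, restricted to the two indices j and ι (a j).
  Paired : Fin (k ℕ.* 2) → Set
  Paired j = Cancelling (v j) (v (ι (a j))) (w j) (w (ι (a j)))

  Hypothesis : Set
  Hypothesis = HypothesisI t k n a v w ⊎ HypothesisII t k n a v w r

  condition1⇒paired : ∀ j → Condition1 t k n a v w (a j) → Paired j
  condition1⇒paired j cond = inj₁ (cond j (ι (a j)) ≡.refl (ι∈Γ (a j)))

  condition2⇒paired : ∀ j → Condition2 t k n a v w (a j) → Paired j
  condition2⇒paired j cond = inj₂ (inj₁ (cond j ≡.refl , cond (ι (a j)) (ι∈Γ (a j))))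

  condition3⇒paired : ∀ j → r ≡ 2 → Condition3 t k n a v w (a j) → Paired j
  condition3⇒paired j r≡2 (x , y , cond) with cond j ≡.refl | cond (ι (a j)) (ι∈Γ (a j))
  ... | inj₁ (vj≡x , wj≡y) | inj₁ (vι≡x , wι≡y) = inj₁ (≡.trans vj≡x (≡.sym vι≡x) , ≡.trans wj≡y (≡.sym wι≡y))
  ... | inj₂ (vj≡y , wj≡x) | inj₂ (vι≡y , wι≡x) = inj₁ (≡.trans vj≡y (≡.sym vι≡y) , ≡.trans wj≡x (≡.sym wι≡x))
  ... | inj₁ (vj≡x , wj≡y) | inj₂ (vι≡y , wι≡x) = inj₂ (inj₂ (r≡2 , ≡.trans vj≡x (≡.sym wι≡x) , ≡.trans vι≡y (≡.sym wj≡y)))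
  ... | inj₂ (vj≡y , wj≡x) | inj₁ (vι≡x , wι≡y) = inj₂ (inj₂ (r≡2 , ≡.trans vj≡y (≡.sym wι≡y) , ≡.trans vι≡x (≡.sym wj≡x)))

  hypothesis⇒paired : Hypothesis → ∀ j → Paired j
  hypothesis⇒paired (inj₁ hypI) j with hypI (a j)
  ... | inj₁ cond1 = condition1⇒paired j cond1
  ... | inj₂ cond2 = condition2⇒paired j cond2
  hypothesis⇒paired (inj₂ (r≡2 , hypII)) j with hypII (a j)
  ... | inj₁ cond1        = condition1⇒paired j cond1
  ... | inj₂ (inj₁ cond2) = condition2⇒paired j cond2
  ... | inj₂ (inj₂ cond3) = condition3⇒paired j r≡2 cond3

  module _ (paired : ∀ j → Paired j) (b : Fin t) where

    pairedAt : ∀ i → a i ≡ b → Cancelling (v i) (v (ι b)) (w i) (w (ι b))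
    pairedAt i ≡.refl = paired i

    paired⇒condition2 : v (ι b) ≡ w (ι b) → Condition2 t k n a v w b
    paired⇒condition2 vι≡wι i ai≡b = cancelling-diagonal (pairedAt i ai≡b) vι≡wι

    paired⇒condition1 : r ≢ 2 → v (ι b) ≢ w (ι b) → Condition1 t k n a v w b
    paired⇒condition1 r≢2 vι≢wι i j ai≡b aj≡b
      with cancelling-offDiagonal (pairedAt i ai≡b) vι≢wι | cancelling-offDiagonal (pairedAt j aj≡b) vι≢wι
    ... | inj₁ (vi≡vι , wi≡wι) | inj₁ (vj≡vι , wj≡wι) = ≡.trans vi≡vι (≡.sym vj≡vι) , ≡.trans wi≡wι (≡.sym wj≡wι)
    ... | inj₂ (r≡2 , _)       | _                    = ⊥-elim (r≢2 r≡2)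
    ... | _                    | inj₂ (r≡2 , _)       = ⊥-elim (r≢2 r≡2)

    paired⇒condition3 : v (ι b) ≢ w (ι b) → Condition3 t k n a v w b
    paired⇒condition3 vι≢wι = v (ι b) , w (ι b) , λ i ai≡b → orient (cancelling-offDiagonal (pairedAt i ai≡b) vι≢wι)
      where
      orient : ∀ {i} → (v i ≡ v (ι b) × w i ≡ w (ι b)) ⊎ (r ≡ 2 × v i ≡ w (ι b) × w i ≡ v (ι b)) →
               (v i ≡ v (ι b) × w i ≡ w (ι b)) ⊎ (v i ≡ w (ι b) × w i ≡ v (ι b))
      orient (inj₁ same)         = inj₁ same
      orient (inj₂ (_ , swapped)) = inj₂ swapped

  paired⇒hypothesis : (∀ j → Paired j) → Hypothesis
  paired⇒hypothesis paired with r ℕ.≟ 2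
  ... | yes r≡2 = inj₂ (r≡2 , at)
    where
    at : ∀ b → Condition1 t k n a v w b ⊎ Condition2 t k n a v w b ⊎ Condition3 t k n a v w b
    at b with v (ι b) ≟ w (ι b)
    ... | yes vι≡wι = inj₂ (inj₁ (paired⇒condition2 paired b vι≡wι))
    ... | no  vι≢wι = inj₂ (inj₂ (paired⇒condition3 paired b vι≢wι))
  ... | no r≢2 = inj₁ at
    where
    at : ∀ b → Condition1 t k n a v w b ⊎ Condition2 t k n a v w b
    at b with v (ι b) ≟ w (ι b)
    ... | yes vι≡wι = inj₂ (paired⇒condition2 paired b vι≡wι)
    ... | no  vι≢wι = inj₁ (paired⇒condition1 paired b r≢2 vι≢wι)

Fin[k*2]⇒0<k : ∀ {k} → Fin (k ℕ.* 2) → 0 ℕ.< k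
Fin[k*2]⇒0<k {suc _} _ = ℕ.z<s

∣-sum : ∀ {d N} {f : Fin N → ℕ} → (∀ j → d ∣ f j) → d ∣ ℕΣ.sum f
∣-sum {d} {zero}  _   = d ∣0
∣-sum {d} {suc N} d∣f = ∣m∣n⇒∣m+n (d∣f Fin.zero) (∣-sum (d∣f ∘ Fin.suc))

module Dichotomy {c ℓ : Level} (R : CommutativeRing c ℓ) (domain : RingStuff.IsIntegralDomain R)
            {r′ : ℕ} {ζ : CommutativeRing.Carrier R} (ζ-primitive : RingStuff.IsPrimitiveRoot R (suc (suc r′)) ζ)
            {t k : ℕ} (a : Fin (k ℕ.* 2) → Fin t) (ι : Fin t → Fin (k ℕ.* 2)) (ι∈Γ : ∀ b → a (ι b) ≡ b)
            {n m : ℕ} (F : Fin m → Fin n → Fin (suc (suc r′))) (independent : IsIndependentFamily m n (4 ℕ.* k) (suc (suc r′)) F)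
            (v w : Fin (k ℕ.* 2) → Fin n) where
  open CommutativeRing R
  open RingStuff R
  open PowersAndSums R
  open CharacterSums R domain
  open Combinations n using (eval; coeff)
  open FourTerms n r′
  open Redistribution a ι ι∈Γ using (distinguished)
  open HashExponent R {k = k} ζ a ι ι∈Γ F v w
  open Pairing {k = k} r′ a ι ι∈Γ v w
  open import Relation.Binary.Reasoning.Setoid setoid

  Z : (Fin (k ℕ.* 2) → Fin m) → Carrier
  Z σ = Hash.Z t k n m r ζ a ι F σ v w

  weight-divisible : ∀ j → Paired j → ∀ h → r ∣ weight h j
  weight-divisible j paired h with distinguished j
  ... | true  = r ∣0
  ... | false = cancelling⇒∣cross (cancelling-map (toℕ ∘ h) paired)

  hypothesis⇒Z≈1 : Hypothesis → ∀ σ → Z σ ≈ 1#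
  hypothesis⇒Z≈1 hyp σ with ∣-sum (λ j → weight-divisible j (hypothesis⇒paired hyp j) (F (σ j)))
  ... | divides q Σ≡q*r = trans (Z-pow σ) (trans (reflexive (≡.cong (pow ζ) Σ≡q*r)) (pow-multiple (proj₁ ζ-primitive) q))

  weight-sum-vanishes : ∀ j → ¬ Paired j → sumFin m (λ s → pow ζ (weight (F s) j)) ≈ 0#
  weight-sum-vanishes j ¬paired with j ≟ ι (a j)
  ... | yes j≡ι = ⊥-elim (¬paired (inj₁ (≡.cong v j≡ι , ≡.cong w j≡ι)))
  ... | no  _   = begin
    sumFin m (λ s → pow ζ (cross (g s A) (g s B) (g s C) (g s D)))
      ≈⟨ sumFin-cong m (λ s → trans (reflexive (≡.cong (pow ζ) (cross-eval (g s) A B C D)))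
                                    (pow-mod (proj₁ ζ-primitive) (eval (g s) (terms A B C D)) (r′ ℕ.* g s D))) ⟩
    sumFin m (λ s → pow ζ (eval (g s) (terms A B C D)))
      ≈⟨ familySum-vanishes ζ-primitive F independent (terms A B C D) 4≤4k (proj₁ ∤coeff) (proj₂ ∤coeff) ⟩
    0# ∎
    where
    A B C D : Fin n
    A = v j
    B = v (ι (a j))
    C = w j
    D = w (ι (a j))
    g : Fin m → Fin n → ℕ
    g s p = toℕ (F s p)
    ∤coeff : Σ (Fin n) λ z → ¬ r ∣ coeff z (terms A B C D)
    ∤coeff = ¬cancelling⇒∤coeff A B C D ¬paired
    4≤4k : 4 ℕ.≤ 4 ℕ.* k
    4≤4k = ℕ.*-monoʳ-≤ 4 (Fin[k*2]⇒0<k {k} j)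

  ¬hypothesis⇒ΣZ≈0 : ¬ Hypothesis → sumFun (k ℕ.* 2) m Z ≈ 0#
  ¬hypothesis⇒ΣZ≈0 ¬hyp = begin
    sumFun (k ℕ.* 2) m Z
      ≈⟨ sumFun-cong (k ℕ.* 2) m (λ σ → trans (Z-pow σ) (sym (prodFin-pow ζ (k ℕ.* 2) _))) ⟩
    sumFun (k ℕ.* 2) m (λ σ → prodFin (k ℕ.* 2) (λ j → pow ζ (weight (F (σ j)) j)))
      ≈⟨ sumFun-prodFin (k ℕ.* 2) m (λ j s → pow ζ (weight (F s) j)) ⟩
    prodFin (k ℕ.* 2) (λ j → sumFin m (λ s → pow ζ (weight (F s) j)))
      ≈⟨ prodFin-zero (k ℕ.* 2) _ (proj₁ unpaired) (weight-sum-vanishes (proj₁ unpaired) (proj₂ unpaired)) ⟩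
    0# ∎
    where
    unpaired : Σ (Fin (k ℕ.* 2)) λ j → ¬ Paired j
    unpaired = ¬∀⟶∃¬ (k ℕ.* 2) Paired (λ j → cancelling? _ _ _ _) (¬hyp ∘ paired⇒hypothesis)

open import Data.Nat using (_≤_; _*_; NonZero; s≤s; z≤n)

theorem3p2 : {c ℓ : Level} (R : CommutativeRing c ℓ) →
    RingStuff.IsIntegralDomain R → RingStuff.CharZero R →
    (r : ℕ) → 2 ≤ r →
    (ζ : CommutativeRing.Carrier R) → RingStuff.IsPrimitiveRoot R r ζ →
    (t k : ℕ) (a : Fin (k * 2) → Fin t) →
    IsSimpleH t k a → IsConnectedH t k a → NoLeaves t k a →
    (ι : Fin t → Fin (k * 2)) → IsDistinguishedChoice t k a ι →
    (n : ℕ) (Adj : Fin n → Fin n → Set) → IsSimpleGraph Adj →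
    (m : ℕ) → .{{NonZero m}} → (F : Fin m → Fin n → Fin r) →
    IsIndependentFamily m n (4 * k) r F →
    (v w : Fin (k * 2) → Fin n) → IsEdgeTuple n k Adj v → IsEdgeTuple n k Adj w →
    ((HypothesisI t k n a v w ⊎ HypothesisII t k n a v w r) →
       ∀ (σ : Fin (k * 2) → Fin m) →
       CommutativeRing._≈_ R (RingStuff.Hash.Z R t k n m r ζ a ι F σ v w) (CommutativeRing.1# R))
    ×
    (¬ (HypothesisI t k n a v w ⊎ HypothesisII t k n a v w r) →
       CommutativeRing._≈_ R
         (RingStuff.sumFun R (k * 2) m (λ σ → RingStuff.Hash.Z R t k n m r ζ a ι F σ v w))
         (CommutativeRing.0# R))
theorem3p2 R domain _ (suc (suc r′)) (s≤s (s≤s z≤n)) ζ ζ-primitive t k a _ _ _ ι ι∈Γ n _ _ m F independent v w _ _ =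
  hypothesis⇒Z≈1 , ¬hypothesis⇒ΣZ≈0
  where open Dichotomy R domain ζ-primitive {k = k} a ι ι∈Γ F independent v w
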